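{- Let $\varphi(x)$ be $\forall z(z=x)$. Then $$\not\vDash_{\mathsf{PI}}[\varphi(0)\wedge\Box\forall x,y\in\mathbb{N}(\varphi(x)\wedge S(x,y)\rightarrow\varphi(y))]\rightarrow\Box\forall x\in\mathbb{N}\;\varphi(x).$$
   Context: PI model: $\mathcal{M}=\langle W,R,D,I\rangle$ with $W$ countably infinite, $R$ a directed partial order, each $D(w)$ non-empty finite, $n$-ary second-order quantifiers at $w$ range over all subsets of $D(w)^n$, $D(w)\subsetneq D(s)$ whenever $R(w,s)$, $w\ne s$, and an injection $\mathbf{a}:\omega\to\bigcup_wD(w)$ with $\#X=\mathbf{a}_{|X|}$ at every world for all $X\subseteq D(s)$, $s\in W$. Kripke semantics: actualist first-order quantifiers over $D(w)$, free variables may denote any object of the model, rigid set variables, $\Box$ over $R$-successors. $\vDash_{\mathsf{PI}}\psi$: $\psi$ true at every world of every PI model. Definitions: $0:=\#\varnothing$; $Sxy:\equiv\Diamond\exists G\exists u[Gu\wedge y=\#G\wedge x=\#(G\setminus\{u\})]$; $S^+(a,b):\equiv\forall X[(\forall x,y(Xx\wedge Sxy\rightarrow Xy)\wedge\forall x(Sax\rightarrow Xx))\rightarrow Xb]$; $S^{+=}(a,b):\equiv S^+(a,b)\vee a=b$; $\mathbb{N}x:\equiv S^{+=}(0,x)\wedge\exists y(y=0)$; $\forall x\in\mathbb{N}\,\psi$ abbreviates $\forall x(\mathbb{N}x\rightarrow\psi)$. -}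

module Defs where

open import Data.Nat using (ℕ)
open import Data.List using (List; []; length)
open import Data.List.Membership.Propositional using (_∈_; _∉_)
open import Data.List.Relation.Binary.Subset.Propositional using (_⊆_)
open import Data.List.Relation.Unary.Unique.Propositional using (Unique)
open import Data.Product using (Σ; ∃; _×_; _,_)
open import Data.Sum using (_⊎_)
open import Function.Bundles using (_↔_)
open import Function.Definitions using (Injective)
open import Relation.Binary.Definitions using ()
open import Relation.Binary.Structures using (IsPartialOrder)
open import Relation.Binary.PropositionalEquality using (_≡_)
open import Relation.Nullary using (¬_)

-- Finite sets of objects (domains, values of monadic second-order
-- variables) are represented by duplicate-free lists; membership is
-- list membership and the cardinality |X| is the length.

record PIModel : Set₁ where
  field
    W     : Set
    Obj   : Set
    R     : W → W → Set
    D     : W → List Obj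
    hash  : W → List Obj → Obj
    a     : ℕ → Obj
    W-countable : W ↔ ℕ
    R-partialOrder : IsPartialOrder _≡_ R
    R-directed : ∀ w v → ∃ λ u → R w u × R v u
    D-unique   : ∀ w → Unique (D w)
    D-nonempty : ∀ w → ∃ λ o → o ∈ D w
    D-growing  : ∀ w s → R w s → ¬ (w ≡ s) →
                 (D w ⊆ D s) × (∃ λ o → o ∈ D s × o ∉ D w)
    Obj-covered : ∀ (o : Obj) → ∃ λ w → o ∈ D w
    a-injective : Injective _≡_ _≡_ a
    hash-a : ∀ w s (X : List Obj) → Unique X → X ⊆ D s → hash w X ≡ a (length X)

-- First-order quantifiers at w range over D(w); free variables
-- may be any object; monadic second-order quantifiers at w range over all
-- subsets of D(w) (rigid); □ ranges over R-successors, ◇ dually.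

module Semantics (M : PIModel) where
  open PIModel M

  SubsetOf : W → List Obj → Set
  SubsetOf w X = Unique X × X ⊆ D w

  IsRemove : List Obj → Obj → List Obj → Set
  IsRemove G u H = Unique H × (∀ z → (z ∈ H → z ∈ G × ¬ (z ≡ u))
                                   × (z ∈ G → ¬ (z ≡ u) → z ∈ H))

  zero' : W → Obj
  zero' w = hash w []

  -- S x y :≡ ◇ ∃G ∃u [G u ∧ y = #G ∧ x = #(G ∖ {u})]
  Succ : W → Obj → Obj → Set
  Succ w x y = ∃ λ s → R w s × Σ (List Obj) λ G → SubsetOf s G ×
               ∃ λ u → u ∈ D s × u ∈ G × y ≡ hash s G ×
               (∃ λ H → IsRemove G u H × x ≡ hash s H)

  -- S⁺(p,q) :≡ ∀X[(∀x,y(Xx ∧ Sxy → Xy) ∧ ∀x(S p x → Xx)) → Xq]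
  Succ⁺ : W → Obj → Obj → Set
  Succ⁺ w p q = ∀ X → SubsetOf w X →
    (∀ x y → x ∈ D w → y ∈ D w → x ∈ X × Succ w x y → y ∈ X) →
    (∀ x → x ∈ D w → Succ w p x → x ∈ X) →
    q ∈ X

  Succ⁺⁼ : W → Obj → Obj → Set
  Succ⁺⁼ w p q = Succ⁺ w p q ⊎ p ≡ q

  -- ℕx :≡ S⁺⁼(0,x) ∧ ∃y(y = 0)
  Nat : W → Obj → Set
  Nat w x = Succ⁺⁼ w (zero' w) x × (∃ λ y → y ∈ D w × y ≡ zero' w)

  φ : W → Obj → Set
  φ w x = ∀ z → z ∈ D w → z ≡ x

  Target : W → Set
  Target w =
    (φ w (zero' w) ×
     (∀ s → R w s → ∀ x → x ∈ D s → Nat s x → ∀ y → y ∈ D s → Nat s y →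
        φ s x × Succ s x y → φ s y))
    → (∀ s → R w s → ∀ x → x ∈ D s → Nat s x → φ s x)

-- The countermodel has worlds ℕ ordered by ≤, domain {0, …, n} at world n
-- and # interpreted as cardinality, so that 0 denotes the object 0 everywhere.
-- At the root the domain is {0}, so φ(0) holds; at every later world the
-- domain has at least two elements, so φ holds of nothing there and the
-- boxed induction step is vacuous.  Yet at world 1 the number 0 fails φ.
module Submission where

open import Defs
open import Data.Empty using (⊥-elim)
open import Data.List using (List; length; downFrom)
open import Data.List.Membership.Propositional using (_∈_)
open import Data.List.Membership.Propositional.Properties using (∈-downFrom⁺; ∈-downFrom⁻)
open import Data.List.Relation.Unary.Any using (here)
open import Data.List.Relation.Unary.Unique.Propositional.Properties using (downFrom⁺)
open import Data.Nat using (ℕ; zero; suc; _≤_; _+_; z≤n; s≤s; s≤s⁻¹)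
open import Data.Nat.Properties using (≤-isPartialOrder; ≤-antisym; ≤-refl; ≤-trans; m≤m+n; m≤n+m)
open import Data.Product using (Σ; _×_; _,_)
open import Data.Sum using (inj₂)
open import Function using (id)
open import Function.Properties.Inverse using (↔-refl)
open import Relation.Binary.PropositionalEquality using (_≡_; refl; sym; trans)
open import Relation.Nullary using (¬_)

segment : ℕ → List ℕ
segment n = downFrom (suc n)

∈-segment⁺ : ∀ {n i} → i ≤ n → i ∈ segment n
∈-segment⁺ i≤n = ∈-downFrom⁺ (s≤s i≤n)

∈-segment⁻ : ∀ {n i} → i ∈ segment n → i ≤ n
∈-segment⁻ i∈ = s≤s⁻¹ (∈-downFrom⁻ i∈)

segment-mono : ∀ {m n} → m ≤ n → ∀ {i} → i ∈ segment m → i ∈ segment n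
segment-mono m≤n i∈ = ∈-segment⁺ (≤-trans (∈-segment⁻ i∈) m≤n)

countermodel : PIModel
countermodel = record
  { W              = ℕ
  ; Obj            = ℕ
  ; R              = _≤_
  ; D              = segment
  ; hash           = λ _ → length
  ; a              = id
  ; W-countable    = ↔-refl
  ; R-partialOrder = ≤-isPartialOrder
  ; R-directed     = λ w v → w + v , m≤m+n w v , m≤n+m v w
  ; D-unique       = λ n → downFrom⁺ (suc n)
  ; D-nonempty     = λ n → 0 , ∈-segment⁺ z≤n
  ; D-growing      = λ w s w≤s w≢s →
      segment-mono w≤s , s , ∈-segment⁺ ≤-refl , λ s∈ → w≢s (≤-antisym w≤s (∈-segment⁻ s∈))
  ; Obj-covered    = λ o → o , ∈-segment⁺ ≤-refl
  ; a-injective    = id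
  ; hash-a         = λ _ _ _ _ _ → refl
  }

open Semantics countermodel

φ-root : ∀ {y} → y ∈ segment 0 → φ 0 y
φ-root (here refl) z (here refl) = refl

¬φ-nonroot : ∀ s x → ¬ φ (suc s) x
¬φ-nonroot s x all≡x with () ← trans (all≡x (suc s) (∈-segment⁺ ≤-refl)) (sym (all≡x 0 (∈-segment⁺ z≤n)))

φ-step : ∀ s → 0 ≤ s → ∀ x → x ∈ segment s → Nat s x → ∀ y → y ∈ segment s → Nat s y →
         φ s x × Succ s x y → φ s y
φ-step zero    _ _ _ _ _ y∈ _ _         = φ-root y∈
φ-step (suc s) _ x _ _ _ _  _ (φx , _) = ⊥-elim (¬φ-nonroot s x φx)

zero-Nat : ∀ w → Nat w 0
zero-Nat w = inj₂ refl , 0 , ∈-segment⁺ z≤n , refl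

lemma22 : Σ PIModel λ M → Σ (PIModel.W M) λ w → ¬ Semantics.Target M w
lemma22 = countermodel , 0 , λ target →
  ¬φ-nonroot 0 0 (target (φ-root (here refl) , φ-step) 1 z≤n 0 (∈-segment⁺ z≤n) (zero-Nat 1))
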